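{- For the ladder graph $G=P_k\,\square\,P_2$ with $k\ge 4$, $\bar{\gamma}_p(G)=\left\lceil\frac{k-4}{3}\right\rceil$.
   Context: $P_k$ is the path on $k$ vertices. The Cartesian product $G\,\square\,H$ has vertex set $V(G)\times V(H)$, with $(u_1,v_1)$ adjacent to $(u_2,v_2)$ iff either $u_1=u_2$ and $\{v_1,v_2\}\in E(H)$, or $\{u_1,u_2\}\in E(G)$ and $v_1=v_2$. For $v\in V$, $N[v]$ is the closed neighborhood; for $S\subseteq V$, $N[S]=\bigcup_{v\in S}N[v]$. Define $\mathcal{P}^0(S)=N[S]$, $\mathcal{P}^{i+1}(S)=\mathcal{P}^i(S)\cup\{w : \{w\}=N[v]\setminus\mathcal{P}^i(S)\text{ for some } v\in\mathcal{P}^i(S)\}$, with eventual value $\mathcal{P}^\infty(S)$. $S$ is a power dominating set (PDS) if $\mathcal{P}^\infty(S)=V$, and a failed power dominating set (FPDS) otherwise. $\bar{\gamma}_p(G)$ is the maximum cardinality of an FPDS of $G$. -}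

module Defs where

open import Data.Nat using (ℕ; zero; suc; _+_)
open import Data.Fin using (Fin; toℕ)
open import Data.Product using (_×_; _,_; Σ; ∃; proj₁; proj₂)
open import Data.Sum using (_⊎_)
open import Data.List using (List)
open import Data.List.Membership.Propositional using (_∈_)
open import Relation.Binary.PropositionalEquality using (_≡_)
open import Relation.Nullary using (¬_)
open import Level using (0ℓ)

record Graph : Set₁ where
  field
    V   : Set
    Adj : V → V → Set
open Graph public

PathAdj : ∀ k → Fin k → Fin k → Set
PathAdj k i j = (suc (toℕ i) ≡ toℕ j) ⊎ (suc (toℕ j) ≡ toℕ i)

Path : ℕ → Graph
Path k = record { V = Fin k ; Adj = PathAdj k }

_□_ : Graph → Graph → Graph
G □ H = record
  { V   = V G × V H
  ; Adj = λ { (u₁ , v₁) (u₂ , v₂) →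
              (u₁ ≡ u₂ × Adj H v₁ v₂) ⊎ (Adj G u₁ u₂ × v₁ ≡ v₂) } }

module _ (G : Graph) where
  InN : V G → V G → Set
  InN v w = (w ≡ v) ⊎ Adj G v w

  InNS : List (V G) → V G → Set
  InNS S w = ∃ λ v → v ∈ S × InN v w

  InP : ℕ → List (V G) → V G → Set
  InP zero    S w = InNS S w
  InP (suc i) S w =
    InP i S w ⊎
    (∃ λ v → InP i S v × InN v w × ¬ InP i S w ×
       (∀ u → InN v u → ¬ InP i S u → u ≡ w))

  InP∞ : List (V G) → V G → Set
  InP∞ S w = ∃ λ i → InP i S w

  IsPDS : List (V G) → Set
  IsPDS S = ∀ w → InP∞ S w

  IsFPDS : List (V G) → Set
  IsFPDS S = ¬ IsPDS S

module Submission where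

-- Whether a vertex is ever observed is not
-- decidable, so for a failed set we reason about ¬¬-observed vertices; on a
-- finite graph the forcing rule holds for them (Forcing.force).  Conversely,
-- a decidable vertex set containing N[S] in which no member has exactly one
-- neighbour outside contains everything S observes (Confinement).
--
-- If two adjacent columns are
-- fully seen, forcing along the rails sees every column, so S would
-- dominate.  Hence the members of a failed S lie in columns 2 … k-3,
-- pairwise three columns apart; the blocks ⌊(c+1)/3⌋ of their columns are
-- distinct elements of 1 … ⌊(k-2)/3⌋, and a pigeonhole count bounds |S|.
--
-- Lower bound (Construction).  The vertices (3t+2, ·) off a zig-zag path,
-- t < ⌊(k-2)/3⌋, fail: the zig-zag together with the hub columns 3t+2 is a
-- confining set, and it misses (0 , 1).

open import Defs
open import Level using (0ℓ)
open import Data.Nat using (ℕ; zero; suc; _≤_; _<_; _+_; _*_; _∸_; _/_; _⊔_; z≤n; s≤s; _≤′_; ≤′-refl; ≤′-step; _≟_; _≤?_)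
open import Data.Nat.Properties using (m≤m⊔n; m≤n⊔m; ≤⇒≤′; <-trans; n<1+n; ≤-refl; ≤-trans; n≤1+n; ≤-reflexive; ≤⇒≯; suc-injective; +-comm; ≤-total; <⇒≢; m+n≤o⇒m≤o∸n; +-assoc; *-monoˡ-≤; +-monoˡ-≤; m∸n+n≡m; +-cancelʳ-≡; m≢1+n+m; m≤n+m; *-cancelʳ-≡; module ≤-Reasoning)
open import Data.Nat.DivMod using (/-monoˡ-≤; m/n≡1+[m∸n]/n; m/n*n≤m)
open import Data.Fin using (Fin; toℕ; fromℕ<) renaming (zero to fzero; suc to fsuc)
open import Data.Fin.Properties using (toℕ-injective; toℕ-fromℕ<; toℕ<n) renaming (_≟_ to _≟ᶠ_)
open import Function using (id)
open import Data.Product using (_×_; _,_; Σ; ∃; proj₁; proj₂)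
open import Data.Sum using (_⊎_; inj₁; inj₂; [_,_]′; map₂)
open import Data.Empty using (⊥; ⊥-elim)
open import Data.List using (List; []; _∷_; length; map; allFin; applyUpTo; cartesianProduct)
open import Data.List.Properties using (length-map; length-tabulate; length-removeAt′; length-applyUpTo)
open import Data.List.Membership.Propositional using (_∈_; _─_)
open import Data.List.Membership.Propositional.Properties using (∈-allFin; ∈-cartesianProduct⁺; ∈-applyUpTo⁺; ∈-map⁻)
open import Data.List.Relation.Unary.Any using (here; there; index)
open import Data.List.Relation.Unary.All as All using (All; []; _∷_)
open import Data.List.Relation.Unary.AllPairs using (_∷_)
open import Data.List.Relation.Unary.Unique.Propositional using (Unique)
open import Data.List.Relation.Unary.Unique.Propositional.Properties using (map⁺; allFin⁺)
open import Relation.Binary.PropositionalEquality using (_≡_; _≢_; refl; sym; trans; cong; subst; ≢-sym)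
open import Relation.Nullary using (¬_; Dec; yes; no)
open import Relation.Nullary.Decidable using (¬¬-excluded-middle; _×-dec_; _⊎-dec_)
open import Relation.Nullary.Negation using (¬¬-Monad; contradiction)
open import Effect.Monad using (RawMonad)
open RawMonad (¬¬-Monad {0ℓ}) using (_>>=_; return)

¬¬-All : ∀ {A : Set} {P : A → Set} → (∀ x → ¬ ¬ P x) → ∀ xs → ¬ ¬ All P xs
¬¬-All h []       = return []
¬¬-All h (x ∷ xs) = do
  px  ← h x
  pxs ← ¬¬-All h xs
  return (px ∷ pxs)

common-stage : ∀ {A : Set} {Q : A → ℕ → Set} →
               (∀ {x i j} → i ≤ j → Q x i → Q x j) →
               ∀ {xs} → All (λ x → ∃ (Q x)) xs → ∃ λ j → All (λ x → Q x j) xs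
common-stage mono []             = 0 , []
common-stage mono ((i , q) ∷ qs) with common-stage mono qs
... | j , qs′ = i ⊔ j , mono (m≤m⊔n i j) q ∷ All.map (mono (m≤n⊔m i j)) qs′

module Forcing (G : Graph) (S : List (V G))
               (vertices : List (V G)) (complete : ∀ v → v ∈ vertices) where

  Observed : V G → Set
  Observed = InP∞ G S

  stage-mono : ∀ {i j w} → i ≤ j → InP G i S w → InP G j S w
  stage-mono le = go (≤⇒≤′ le)
    where
      go : ∀ {i j w} → i ≤′ j → InP G i S w → InP G j S w
      go ≤′-refl       p = p
      go (≤′-step le′) p = inj₁ (go le′ p)

  -- Finiteness of the vertex set supplies
  -- a common stage at which all those neighbours are already observed.
  force : ∀ {v w} → ¬ ¬ Observed v → InN G v w →
          (∀ u → InN G v u → u ≢ w → ¬ ¬ Observed u) → ¬ ¬ Observed w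
  force {v} {w} seen-v vw others = ¬¬-All stage-of vertices >>= λ stages →
    let (j , at-j) = common-stage reached-mono stages
    in  from-stage j (λ u → All.lookup at-j (complete u))
    where
      Reached : V G → ℕ → Set
      Reached u i = InN G v u → u ≡ w ⊎ InP G i S u

      reached-mono : ∀ {u i j} → i ≤ j → Reached u i → Reached u j
      reached-mono le r vu = map₂ (stage-mono le) (r vu)

      stage-of : ∀ u → ¬ ¬ ∃ (Reached u)
      stage-of u = ¬¬-excluded-middle >>= λ where
        (yes u≡w) → return (0 , λ _ → inj₁ u≡w)
        (no u≢w)  → ¬¬-excluded-middle >>= λ where
          (no ¬vu) → return (0 , λ vu → contradiction vu ¬vu)
          (yes vu) → others u vu u≢w >>= λ (i , pu) → return (i , λ _ → inj₂ pu)

      from-stage : ∀ j → (∀ u → Reached u j) → ¬ ¬ Observed w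
      from-stage j reached with reached v (inj₁ refl)
      ... | inj₁ v≡w = subst (λ x → ¬ ¬ Observed x) v≡w seen-v
      ... | inj₂ pv  = ¬¬-excluded-middle >>= λ where
        (yes pw)  → return (j , pw)
        (no ¬pw) → return (suc j , inj₂ (v , pv , vw , ¬pw , only-w))
          where
            only-w : ∀ u → InN G v u → ¬ InP G j S u → u ≡ w
            only-w u vu ¬pu = [ id , (λ pu → contradiction pu ¬pu) ]′ (reached u vu)

  ¬¬-dominating : (∀ w → ¬ ¬ Observed w) → ¬ ¬ IsPDS G S
  ¬¬-dominating seen = ¬¬-All seen vertices >>= λ all →
    return (λ w → All.lookup all (complete w))

ForcingClosed : (G : Graph) → (V G → Set) → Set
ForcingClosed G T = ∀ {v w} → T v → InN G v w → ¬ T w →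
                    ∃ λ u → InN G v u × ¬ T u × u ≢ w

module Confinement (G : Graph) (S : List (V G)) (T : V G → Set) (T? : ∀ w → Dec (T w))
                   (seed : ∀ {s w} → s ∈ S → InN G s w → T w) (closed : ForcingClosed G T) where

  confined : ∀ i {w} → InP G i S w → T w
  confined zero    (s , s∈S , sw) = seed s∈S sw
  confined (suc i) (inj₁ p) = confined i p
  confined (suc i) {w} (inj₂ (v , pv , vw , _ , only-w)) with T? w
  ... | yes tw = tw
  ... | no ¬tw = let (u , vu , ¬tu , u≢w) = closed (confined i pv) vw ¬tw
                 in  contradiction (only-w u vu (λ pu → ¬tu (confined i pu))) u≢w

  failed : ∀ w → ¬ T w → IsFPDS G S
  failed w ¬tw pds = let (i , pw) = pds w in ¬tw (confined i pw)

Ladder : ℕ → Graph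
Ladder k = Path k □ Path 2

other : Fin 2 → Fin 2
other fzero        = fsuc fzero
other (fsuc fzero) = fzero

other-involutive : ∀ a → other (other a) ≡ a
other-involutive fzero        = refl
other-involutive (fsuc fzero) = refl

other-≢ : ∀ a → a ≢ other a
other-≢ fzero        ()
other-≢ (fsuc fzero) ()

rows : ∀ a b → b ≡ a ⊎ b ≡ other a
rows fzero        fzero        = inj₁ refl
rows fzero        (fsuc fzero) = inj₂ refl
rows (fsuc fzero) fzero        = inj₂ refl
rows (fsuc fzero) (fsuc fzero) = inj₁ refl

row-flip : ∀ {r p} → r ≢ other p → r ≡ p
row-flip {r} {p} r≢ with rows p r
... | inj₁ r≡ = r≡
... | inj₂ r≡ = contradiction r≡ r≢

rung-adj : ∀ {a b} → PathAdj 2 a b → b ≡ other a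
rung-adj {fzero}      {fzero}      (inj₁ ())
rung-adj {fzero}      {fzero}      (inj₂ ())
rung-adj {fzero}      {fsuc fzero} _ = refl
rung-adj {fsuc fzero} {fzero}      _ = refl
rung-adj {fsuc fzero} {fsuc fzero} (inj₁ ())
rung-adj {fsuc fzero} {fsuc fzero} (inj₂ ())

rung-adj⁺ : ∀ a → PathAdj 2 a (other a)
rung-adj⁺ fzero        = inj₁ refl
rung-adj⁺ (fsuc fzero) = inj₂ refl

data LadderNbr {k} (c : Fin k) (a : Fin 2) : Fin k × Fin 2 → Set where
  self  : LadderNbr c a (c , a)
  rung  : LadderNbr c a (c , other a)
  above : ∀ {d} → suc (toℕ c) ≡ toℕ d → LadderNbr c a (d , a)
  below : ∀ {d} → suc (toℕ d) ≡ toℕ c → LadderNbr c a (d , a)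

ladder-nbr : ∀ {k c a u} → InN (Ladder k) (c , a) u → LadderNbr c a u
ladder-nbr (inj₁ refl)                          = self
ladder-nbr {c = c} {a} (inj₂ (inj₁ (refl , ab))) =
  subst (λ b → LadderNbr c a (c , b)) (sym (rung-adj ab)) rung
ladder-nbr (inj₂ (inj₂ (inj₁ up , refl)))       = above up
ladder-nbr (inj₂ (inj₂ (inj₂ down , refl)))     = below down

ladder-nbr⁻ : ∀ {k c a u} → LadderNbr c a u → InN (Ladder k) (c , a) u
ladder-nbr⁻ self          = inj₁ refl
ladder-nbr⁻ {a = a} rung  = inj₂ (inj₁ (refl , rung-adj⁺ a))
ladder-nbr⁻ (above up)    = inj₂ (inj₂ (inj₁ up , refl))
ladder-nbr⁻ (below down)  = inj₂ (inj₂ (inj₂ down , refl))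

rail : ∀ {k} {c d : Fin k} {a} → PathAdj k c d → LadderNbr c a (d , a)
rail = [ above , below ]′

ladder-vertices : ∀ k → List (Fin k × Fin 2)
ladder-vertices k = cartesianProduct (allFin k) (allFin 2)

ladder-complete : ∀ {k} (v : Fin k × Fin 2) → v ∈ ladder-vertices k
ladder-complete (c , a) = ∈-cartesianProduct⁺ (∈-allFin c) (∈-allFin a)

gap : ∀ {d e} → d ≤ e → e ≡ d ⊎ e ≡ suc d ⊎ e ≡ suc (suc d) ⊎ 3 + d ≤ e
gap {zero} {zero}                   _        = inj₁ refl
gap {zero} {suc zero}               _        = inj₂ (inj₁ refl)
gap {zero} {suc (suc zero)}         _        = inj₂ (inj₂ (inj₁ refl))
gap {zero} {suc (suc (suc e))}      _        = inj₂ (inj₂ (inj₂ (s≤s (s≤s (s≤s z≤n)))))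
gap {suc d} {suc e} (s≤s d≤e) with gap d≤e
... | inj₁ e≡               = inj₁ (cong suc e≡)
... | inj₂ (inj₁ e≡)        = inj₂ (inj₁ (cong suc e≡))
... | inj₂ (inj₂ (inj₁ e≡)) = inj₂ (inj₂ (inj₁ (cong suc e≡)))
... | inj₂ (inj₂ (inj₂ le)) = inj₂ (inj₂ (inj₂ (s≤s le)))

-- Reasoning about which vertices get observed is classical, so we work
-- with Seen = ¬¬ Observed; columns are addressed by their index in ℕ.
module FailedLadder (k : ℕ) (two-columns : 2 ≤ k) (S : List (Fin k × Fin 2))
                    (fails : IsFPDS (Ladder k) S) where

  open Forcing (Ladder k) S (ladder-vertices k) ladder-complete

  Seen : Fin k × Fin 2 → Set
  Seen w = ¬ ¬ Observed w

  -- Row a of column n is seen (vacuous if there is no column n).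
  SeenAt : ℕ → Fin 2 → Set
  SeenAt n a = ∀ {c} → toℕ c ≡ n → Seen (c , a)

  -- Row a of the column below column n is seen (vacuous for n = 0).
  SeenBelow : ℕ → Fin 2 → Set
  SeenBelow n a = ∀ {m} → suc m ≡ n → SeenAt m a

  Full : ℕ → Set
  Full n = ∀ a → SeenAt n a

  seen-beyond : ∀ {n} a → k ≤ n → SeenAt n a
  seen-beyond a k≤n {c} refl = contradiction (toℕ<n c) (≤⇒≯ k≤n)

  below-zero : ∀ a → SeenBelow 0 a
  below-zero a ()

  below-suc : ∀ {n a} → SeenAt n a → SeenBelow (suc n) a
  below-suc seen refl = seen

  full : ∀ {n a} → SeenAt n a → SeenAt n (other a) → Full n
  full {n} {a} seen seen′ b with rows a b
  ... | inj₁ refl = seen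
  ... | inj₂ refl = seen′

  force-ladder : ∀ {c a w} → Seen (c , a) → LadderNbr c a w →
                 (∀ {u} → LadderNbr c a u → u ≢ w → Seen u) → Seen w
  force-ladder seen cw others =
    force seen (ladder-nbr⁻ cw) (λ u cu u≢w → others (ladder-nbr cu) u≢w)

  same-vertex : ∀ {c d : Fin k} {a : Fin 2} → toℕ c ≡ toℕ d → (c , a) ≡ (d , a)
  same-vertex {a = a} c≡d = cong (λ x → x , a) (toℕ-injective c≡d)

  force-up : ∀ {n a} → SeenAt n a → SeenAt n (other a) → SeenBelow n a → SeenAt (suc n) a
  force-up {n} {a} seen rung-seen low {d} d≡ = force-ladder (seen c≡) (above up) others
    where
      c : Fin k
      c = fromℕ< (<-trans (n<1+n n) (subst (_< k) d≡ (toℕ<n d)))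
      c≡ : toℕ c ≡ n
      c≡ = toℕ-fromℕ< _
      up : suc (toℕ c) ≡ toℕ d
      up = trans (cong suc c≡) (sym d≡)
      others : ∀ {u} → LadderNbr c a u → u ≢ (d , a) → Seen u
      others self          _   = seen c≡
      others rung          _   = rung-seen c≡
      others (above up′)   u≢w = contradiction (same-vertex (trans (sym up′) up)) u≢w
      others (below down)  _   = low (trans down c≡) refl

  force-down : ∀ {n a} → suc n < k → SeenAt (suc n) a → SeenAt (suc n) (other a) →
               SeenAt (suc (suc n)) a → SeenAt n a
  force-down {n} {a} lt seen rung-seen high {d} d≡ = force-ladder (seen c≡) (below down) others
    where
      c : Fin k
      c = fromℕ< lt
      c≡ : toℕ c ≡ suc n
      c≡ = toℕ-fromℕ< lt
      down : suc (toℕ d) ≡ toℕ c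
      down = trans (cong suc d≡) (sym c≡)
      others : ∀ {u} → LadderNbr c a u → u ≢ (d , a) → Seen u
      others self          _   = seen c≡
      others rung          _   = rung-seen c≡
      others (above up)    _   = high (trans (sym up) (cong suc c≡))
      others (below down′) u≢w = contradiction (same-vertex (suc-injective (trans down′ (sym down)))) u≢w

  force-rung : ∀ {n a} → SeenAt n a → SeenAt (suc n) a → SeenBelow n a → SeenAt n (other a)
  force-rung {n} {a} seen high low {c} c≡ = force-ladder (seen c≡) rung others
    where
      others : ∀ {u} → LadderNbr c a u → u ≢ (c , other a) → Seen u
      others self         _   = seen c≡
      others rung         u≢w = contradiction refl u≢w
      others (above up)   _   = high (trans (sym up) (cong suc c≡))
      others (below down) _   = low (trans down c≡) refl

  member-sees : ∀ {c a u} → (c , a) ∈ S → LadderNbr c a u → Seen u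
  member-sees mem nbr unobserved = unobserved (0 , _ , mem , ladder-nbr⁻ nbr)

  member-column : ∀ {c a n} → (c , a) ∈ S → toℕ c ≡ n → Full n
  member-column {c} {a} {n} mem c≡ =
    full (λ c′≡ → at-column c′≡ self) (λ c′≡ → at-column c′≡ rung)
    where
      at-column : ∀ {c′ b} → toℕ c′ ≡ n → LadderNbr c a (c , b) → Seen (c′ , b)
      at-column c′≡ nbr = subst Seen (same-vertex (trans c≡ (sym c′≡))) (member-sees mem nbr)

  member-above : ∀ {c a n} → (c , a) ∈ S → toℕ c ≡ n → SeenAt (suc n) a
  member-above mem c≡ d≡ = member-sees mem (above (trans (cong suc c≡) (sym d≡)))

  member-below : ∀ {c a n} → (c , a) ∈ S → toℕ c ≡ n → SeenBelow n a
  member-below mem c≡ m≡ d≡ = member-sees mem (below (trans (cong suc d≡) (trans m≡ (sym c≡))))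

  spread-up : ∀ {n} → Full n → Full (suc n) → Full (suc (suc n))
  spread-up fn fsn a = force-up (fsn a) (fsn (other a)) (below-suc (fn a))

  spread-down : ∀ {n} → suc n < k → Full (suc n) → Full (suc (suc n)) → Full n
  spread-down lt fsn fssn a = force-down lt (fsn a) (fsn (other a)) (fssn a)

  descend : ∀ n → suc n < k → Full n → Full (suc n) → Full 0 × Full 1
  descend zero    _  f0  f1   = f0 , f1
  descend (suc n) lt fsn fssn = descend n lt′ (spread-down lt′ fsn fssn) fsn
    where
      lt′ : suc n < k
      lt′ = <-trans (n<1+n (suc n)) lt

  ascend : ∀ m → Full 0 → Full 1 → Full m × Full (suc m)
  ascend zero    f0 f1 = f0 , f1
  ascend (suc m) f0 f1 with ascend m f0 f1
  ... | fm , fsm = fsm , spread-up fm fsm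

  no-adjacent-full : ∀ {n} → suc n < k → Full n → Full (suc n) → ⊥
  no-adjacent-full {n} lt fn fsn = ¬¬-dominating seen-all fails
    where
      seen-all : ∀ w → Seen w
      seen-all (c , a) with descend n lt fn fsn
      ... | f0 , f1 = proj₁ (ascend (toℕ c) f0 f1) a refl

  -- No member of S lies in one of the two outermost columns at either end:
  -- in each case its neighbourhood forces a second full column next to a full one.
  not-first : ∀ {c a} → (c , a) ∈ S → toℕ c ≢ 0
  not-first {a = a} mem c≡ = no-adjacent-full two-columns f0 f1
    where
      f0 : Full 0
      f0 = member-column mem c≡
      f1 : Full 1
      f1 = full (member-above mem c≡) (force-up (f0 (other a)) (f0 (other (other a))) (below-zero _))

  not-second : ∀ {c a} → (c , a) ∈ S → toℕ c ≢ 1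
  not-second {c} {a} mem c≡ = no-adjacent-full (subst (_< k) c≡ (toℕ<n c)) f0 f1
    where
      f1 : Full 1
      f1 = member-column mem c≡
      f0 : Full 0
      f0 = full (member-below mem c≡ refl) (force-rung (member-below mem c≡ refl) (f1 a) (below-zero a))

  not-last : ∀ {c a n} → (c , a) ∈ S → toℕ c ≡ suc n → suc (suc n) ≢ k
  not-last {c} {a} {n} mem c≡ last = no-adjacent-full lt fn fsn
    where
      lt : suc n < k
      lt = subst (_< k) c≡ (toℕ<n c)
      fsn : Full (suc n)
      fsn = member-column mem c≡
      fn : Full n
      fn = full (member-below mem c≡ refl)
                 (force-down lt (fsn (other a)) (fsn (other (other a))) (seen-beyond _ (≤-reflexive (sym last))))

  not-penultimate : ∀ {c a n} → (c , a) ∈ S → toℕ c ≡ n → suc (suc n) ≢ k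
  not-penultimate {c} {a} {n} mem c≡ last = no-adjacent-full lt fn fsn
    where
      lt : suc n < k
      lt = subst (suc n <_) last ≤-refl
      fn : Full n
      fn = member-column mem c≡
      fsn : Full (suc n)
      fsn = full (member-above mem c≡)
                 (force-rung (member-above mem c≡) (seen-beyond _ (≤-reflexive (sym last))) (below-suc (fn a)))

  interior : ∀ {c a} → (c , a) ∈ S → 2 ≤ toℕ c × 3 + toℕ c ≤ k
  interior {c} mem = two≤ , upper (toℕ c) refl two≤
    where
      lower : ∀ n → toℕ c ≡ n → 2 ≤ n
      lower zero          c≡ = contradiction c≡ (not-first mem)
      lower (suc zero)    c≡ = contradiction c≡ (not-second mem)
      lower (suc (suc n)) _  = s≤s (s≤s z≤n)
      two≤ : 2 ≤ toℕ c
      two≤ = lower (toℕ c) refl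
      upper : ∀ n → toℕ c ≡ n → 2 ≤ n → 3 + n ≤ k
      upper (suc n) c≡ _ with gap (subst (_< k) c≡ (toℕ<n c))
      ... | inj₁ k≡               = contradiction (sym k≡) (not-last mem c≡)
      ... | inj₂ (inj₁ k≡)        = contradiction (sym k≡) (not-penultimate mem c≡)
      ... | inj₂ (inj₂ (inj₁ k≡)) = ≤-reflexive (sym k≡)
      ... | inj₂ (inj₂ (inj₂ le)) = ≤-trans (n≤1+n _) le

  spaced : ∀ {c a c′ a′} → (c , a) ∈ S → (c′ , a′) ∈ S → (c , a) ≢ (c′ , a′) →
           toℕ c ≤ toℕ c′ → 3 + toℕ c ≤ toℕ c′
  spaced {c} {a} {c′} {a′} mem mem′ distinct c≤c′ with gap c≤c′
  ... | inj₁ c′≡ with rows a a′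
  ...   | inj₁ refl = contradiction (same-vertex (sym c′≡)) distinct
  ...   | inj₂ refl = ⊥-elim (no-adjacent-full (≤-trans (n≤1+n _) (proj₂ (interior mem)))
                        (member-column mem refl) (full (member-above mem refl) (member-above mem′ c′≡)))
  spaced {c} {a} {c′} mem mem′ _ _ | inj₂ (inj₁ c′≡) =
    ⊥-elim (no-adjacent-full (subst (_< k) c′≡ (toℕ<n c′)) (member-column mem refl) (member-column mem′ c′≡))
  spaced {c} {a} {c′} mem mem′ _ _ | inj₂ (inj₂ (inj₁ c′≡)) =
    ⊥-elim (no-adjacent-full (<-trans (n<1+n _) (subst (_< k) c′≡ (toℕ<n c′))) (member-column mem refl) fsn)
    where
      -- the middle column: row a seen from (c , a), the other row forced by its rung
      fsn : Full (suc (toℕ c))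
      fsn = full (member-above mem refl)
                 (force-rung (member-above mem refl) (member-column mem′ c′≡ a) (below-suc (member-column mem refl a)))
  spaced _ _ _ _ | inj₂ (inj₂ (inj₂ far)) = far

∈-─ : ∀ {A : Set} {x y : A} {xs} (x∈xs : x ∈ xs) → y ∈ xs → y ≢ x → y ∈ xs ─ x∈xs
∈-─ (here refl)  (here y≡x) y≢x = contradiction y≡x y≢x
∈-─ (here refl)  (there y∈) _   = y∈
∈-─ (there x∈xs) (here y≡z) _   = here y≡z
∈-─ (there x∈xs) (there y∈) y≢x = there (∈-─ x∈xs y∈ y≢x)

injection-length : ∀ {A B : Set} (f : A → B) {xs : List A} {ys : List B} → Unique xs →
                   (∀ {x y} → x ∈ xs → y ∈ xs → x ≢ y → f x ≢ f y) →
                   (∀ {x} → x ∈ xs → f x ∈ ys) → length xs ≤ length ys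
injection-length f {[]}     _                _   _    = z≤n
injection-length f {x ∷ xs} {ys} (x∉xs ∷ uniq) inj into =
  subst (suc (length xs) ≤_) (sym (length-removeAt′ ys (index fx∈ys)))
        (s≤s (injection-length f uniq (λ x∈ y∈ → inj (there x∈) (there y∈)) into-rest))
  where
    fx∈ys : f x ∈ ys
    fx∈ys = into (here refl)
    into-rest : ∀ {y} → y ∈ xs → f y ∈ ys ─ fx∈ys
    into-rest y∈ = ∈-─ fx∈ys (into (there y∈))
                          (inj (there y∈) (here refl) (λ y≡x → All.lookup x∉xs y∈ (sym y≡x)))

slot : ℕ → ℕ
slot n = suc n / 3

slot-< : ∀ {m n} → 3 + m ≤ n → slot m < slot n
slot-< {m} {n} le = subst (slot m <_) (sym (m/n≡1+[m∸n]/n three≤)) (s≤s (/-monoˡ-≤ 3 room))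
  where
    three≤ : 3 ≤ suc n
    three≤ = ≤-trans (s≤s (s≤s (s≤s z≤n))) (≤-trans le (n≤1+n n))
    room : suc m ≤ suc n ∸ 3
    room = m+n≤o⇒m≤o∸n (suc m) (s≤s (subst (_≤ n) (+-comm 3 m) le))

∈-1…M : ∀ {s M} → 1 ≤ s → s ≤ M → s ∈ applyUpTo suc M
∈-1…M {suc s} _ s≤M = ∈-applyUpTo⁺ suc s≤M

column-bound : ∀ {n k} → 2 ≤ n → 3 + n ≤ k → suc n ≤ (k ∸ 4) + 2
column-bound {suc (suc n)} {suc (suc (suc (suc k)))} (s≤s (s≤s _)) (s≤s (s≤s (s≤s (s≤s le)))) =
  subst (suc (suc (suc n)) ≤_) (+-comm 2 k) (s≤s (s≤s le))

slot-range : ∀ {n k} → 2 ≤ n → 3 + n ≤ k → slot n ∈ applyUpTo suc (((k ∸ 4) + 2) / 3)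
slot-range two≤ le = ∈-1…M (/-monoˡ-≤ 3 (s≤s two≤)) (/-monoˡ-≤ 3 (column-bound two≤ le))

failed-size : ∀ k → 2 ≤ k → (S : List (Fin k × Fin 2)) → Unique S → IsFPDS (Ladder k) S →
              length S ≤ ((k ∸ 4) + 2) / 3
failed-size k two-columns S uniq fails =
  subst (length S ≤_) (length-applyUpTo suc _) (injection-length block uniq distinct-blocks in-range)
  where
    open FailedLadder k two-columns S fails

    block : Fin k × Fin 2 → ℕ
    block (c , _) = slot (toℕ c)

    distinct-blocks : ∀ {x y} → x ∈ S → y ∈ S → x ≢ y → block x ≢ block y
    distinct-blocks {c , _} {c′ , _} x∈ y∈ x≢y with ≤-total (toℕ c) (toℕ c′)
    ... | inj₁ le = <⇒≢ (slot-< (spaced x∈ y∈ x≢y le))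
    ... | inj₂ le = ≢-sym (<⇒≢ (slot-< (spaced y∈ x∈ (≢-sym x≢y) le)))

    in-range : ∀ {x} → x ∈ S → block x ∈ applyUpTo suc (((k ∸ 4) + 2) / 3)
    in-range x∈ = let (two≤ , room) = interior x∈ in slot-range two≤ room

-- The row of the zig-zag path through the ladder: alternate rows column by column.
parity : ℕ → Fin 2
parity zero    = fzero
parity (suc n) = other (parity n)

adjacent-parity : ∀ {k} {c d : Fin k} → PathAdj k c d → parity (toℕ d) ≡ other (parity (toℕ c))
adjacent-parity (inj₁ up)   = cong parity (sym up)
adjacent-parity (inj₂ down) =
  sym (trans (cong (λ n → other (parity n)) (sym down)) (other-involutive _))

-- n mod 3, by a recursion that suits case analysis.
mod3 : ℕ → ℕ
mod3 zero                = 0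
mod3 (suc zero)          = 1
mod3 (suc (suc zero))    = 2
mod3 (suc (suc (suc n))) = mod3 n

mod3-next : ∀ n → mod3 n ≡ 2 → mod3 (suc n) ≢ 2
mod3-next (suc (suc zero))    _  ()
mod3-next (suc (suc (suc n))) eq = mod3-next n eq

mod3-next₂ : ∀ n → mod3 n ≡ 2 → mod3 (suc (suc n)) ≢ 2
mod3-next₂ (suc (suc zero))    _  ()
mod3-next₂ (suc (suc (suc n))) eq = mod3-next₂ n eq

mod3-≥2 : ∀ n → mod3 n ≡ 2 → 2 ≤ n
mod3-≥2 (suc (suc n)) _ = s≤s (s≤s z≤n)

mod3-hub : ∀ t → mod3 (t * 3 + 2) ≡ 2
mod3-hub zero    = refl
mod3-hub (suc t) = mod3-hub t

-- Everything observed
-- stays inside Covered = zig-zag ∪ hub columns, which misses (0 , 1).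
module Construction (k : ℕ) (four-columns : 4 ≤ k) where

  M : ℕ
  M = ((k ∸ 4) + 2) / 3

  Hub : ℕ → Set
  Hub n = mod3 n ≡ 2 × 3 + n ≤ k

  hub? : ∀ n → Dec (Hub n)
  hub? n = (mod3 n ≟ 2) ×-dec (3 + n ≤? k)

  hub-no-next : ∀ {n} → Hub n → ¬ Hub (suc n)
  hub-no-next {n} (h , _) (h′ , _) = mod3-next n h h′

  hub-no-next₂ : ∀ {n} → Hub n → ¬ Hub (suc (suc n))
  hub-no-next₂ {n} (h , _) (h′ , _) = mod3-next₂ n h h′

  hub-column : ∀ t → t < M → Hub (t * 3 + 2)
  hub-column t t<M = mod3-hub t , (begin
    3 + (t * 3 + 2)        ≡⟨ +-assoc 3 (t * 3) 2 ⟨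
    suc t * 3 + 2          ≤⟨ +-monoˡ-≤ 2 (*-monoˡ-≤ 3 t<M) ⟩
    M * 3 + 2              ≤⟨ +-monoˡ-≤ 2 (m/n*n≤m ((k ∸ 4) + 2) 3) ⟩
    (k ∸ 4) + 2 + 2        ≡⟨ +-assoc (k ∸ 4) 2 2 ⟩
    (k ∸ 4) + 4            ≡⟨ m∸n+n≡m four-columns ⟩
    k                      ∎)
    where open ≤-Reasoning

  column : ∀ n → n < k → ∃ λ (c : Fin k) → toℕ c ≡ n
  column n n<k = fromℕ< n<k , toℕ-fromℕ< n<k

  hub-in-range : ∀ {n} → Hub n → n < k
  hub-in-range {n} (_ , room) = ≤-trans (m≤n+m (suc n) 2) room

  hub-col : Fin M → Fin k
  hub-col t = fromℕ< (hub-in-range (hub-column _ (toℕ<n t)))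

  toℕ-hub-col : ∀ t → toℕ (hub-col t) ≡ toℕ t * 3 + 2
  toℕ-hub-col t = toℕ-fromℕ< _

  hub-vertex : Fin M → Fin k × Fin 2
  hub-vertex t = hub-col t , other (parity (toℕ (hub-col t)))

  hubs : List (Fin k × Fin 2)
  hubs = map hub-vertex (allFin M)

  hubs-length : length hubs ≡ M
  hubs-length = trans (length-map hub-vertex (allFin M)) (length-tabulate (λ t → t))

  hubs-unique : Unique hubs
  hubs-unique = map⁺ injective (allFin⁺ M)
    where
      injective : ∀ {t t′} → hub-vertex t ≡ hub-vertex t′ → t ≡ t′
      injective {t} {t′} eq = toℕ-injective (*-cancelʳ-≡ (toℕ t) (toℕ t′) 3
        (+-cancelʳ-≡ 2 (toℕ t * 3) (toℕ t′ * 3)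
          (trans (sym (toℕ-hub-col t)) (trans (cong (λ v → toℕ (proj₁ v)) eq) (toℕ-hub-col t′)))))

  Covered : Fin k × Fin 2 → Set
  Covered (c , r) = r ≡ parity (toℕ c) ⊎ Hub (toℕ c)

  covered? : ∀ v → Dec (Covered v)
  covered? (c , r) = (r ≟ᶠ parity (toℕ c)) ⊎-dec hub? (toℕ c)

  uncovered : ∀ {c r} → r ≢ parity (toℕ c) → ¬ Hub (toℕ c) → ¬ Covered (c , r)
  uncovered off-row no-hub = [ off-row , no-hub ]′

  seed : ∀ {s w} → s ∈ hubs → InN (Ladder k) s w → Covered w
  seed s∈ sw with ∈-map⁻ hub-vertex s∈
  ... | t , _ , refl with ladder-nbr sw
  ...   | self       = inj₂ (subst Hub (sym (toℕ-hub-col t)) (hub-column _ (toℕ<n t)))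
  ...   | rung       = inj₂ (subst Hub (sym (toℕ-hub-col t)) (hub-column _ (toℕ<n t)))
  ...   | above up   = inj₁ (sym (adjacent-parity (inj₁ up)))
  ...   | below down = inj₁ (sym (adjacent-parity (inj₂ down)))

  off-zigzag : ∀ {c d : Fin k} {r} → r ≡ parity (toℕ c) → PathAdj k c d → r ≢ parity (toℕ d)
  off-zigzag r≡ cd r≡′ = other-≢ _ (trans (sym r≡) (trans r≡′ (adjacent-parity cd)))

  hub-neighbours : ∀ {c d : Fin k} → Hub (toℕ c) → PathAdj k c d → ¬ Hub (toℕ d)
  hub-neighbours h (inj₁ up)   h′ = hub-no-next h (subst Hub (sym up) h′)
  hub-neighbours h (inj₂ down) h′ = hub-no-next h′ (subst Hub (sym down) h)

  opposite-rail : ∀ {c d : Fin k} → Hub (toℕ c) → PathAdj k c d →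
                  ∃ λ d′ → PathAdj k c d′ × toℕ d′ ≢ toℕ d
  opposite-rail {c} h (inj₁ up) = from-below (toℕ c) refl (mod3-≥2 _ (proj₁ h))
    where
      from-below : ∀ n → toℕ c ≡ n → 2 ≤ n → ∃ λ d′ → PathAdj k c d′ × toℕ d′ ≢ _
      from-below (suc m) c≡ _ with column m (<-trans (n<1+n m) (subst (_< k) c≡ (toℕ<n c)))
      ... | d′ , d′≡ = d′ , inj₂ (trans (cong suc d′≡) (sym c≡))
                     , λ eq → m≢1+n+m m (trans (sym d′≡) (trans eq (trans (sym up) (cong suc c≡))))
  opposite-rail {c} h (inj₂ down) with column (suc (toℕ c)) (<-trans (n<1+n _) (proj₂ h))
  ... | d′ , d′≡ = d′ , inj₁ (sym d′≡)
                 , λ eq → m≢1+n+m (toℕ c) (trans (sym down) (cong suc (trans (sym eq) d′≡)))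

  non-hub-neighbour : ∀ {c : Fin k} → ¬ Hub (toℕ c) → ∃ λ d → PathAdj k c d × ¬ Hub (toℕ d)
  non-hub-neighbour {c} no-hub = from (toℕ c) refl
    where
      from : ∀ n → toℕ c ≡ n → ∃ λ d → PathAdj k c d × ¬ Hub (toℕ d)
      from zero c≡ with column 1 (≤-trans (s≤s (s≤s z≤n)) four-columns)
      ... | d , d≡ = d , inj₁ (trans (cong suc c≡) (sym d≡)) , λ h → mod3-1 (subst Hub d≡ h)
        where mod3-1 : ¬ Hub 1
              mod3-1 (() , _)
      from (suc m) c≡ with hub? m
      ... | no ¬h with column m (<-trans (n<1+n m) (subst (_< k) c≡ (toℕ<n c)))
      ...   | d , d≡ = d , inj₂ (trans (cong suc d≡) (sym c≡)) , λ h → ¬h (subst Hub d≡ h)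
      from (suc m) c≡ | yes h with column (suc (suc m)) (proj₂ h)
      ...   | d , d≡ = d , inj₁ (trans (cong suc c≡) (sym d≡)) , λ h′ → hub-no-next₂ h (subst Hub d≡ h′)

  rung-on-zigzag : ∀ {c r} → ¬ Covered (c , other r) → r ≡ parity (toℕ c)
  rung-on-zigzag ¬cw = row-flip (λ r≡ → ¬cw (inj₁ (trans (cong other r≡) (other-involutive _))))

  rail-on-zigzag : ∀ {c d r} → PathAdj k c d → ¬ Covered (d , r) → r ≡ parity (toℕ c)
  rail-on-zigzag cd ¬cw = row-flip (λ r≡ → ¬cw (inj₁ (trans r≡ (sym (adjacent-parity cd)))))

  closed-rung : ∀ {c r} → ¬ Covered (c , other r) →
                ∃ λ u → InN (Ladder k) (c , r) u × ¬ Covered u × u ≢ (c , other r)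
  closed-rung {c} {r} ¬cw with non-hub-neighbour (λ h → ¬cw (inj₂ h))
  ... | d , cd , free = (d , r) , ladder-nbr⁻ (rail cd)
                      , uncovered (off-zigzag (rung-on-zigzag ¬cw) cd) free
                      , λ eq → other-≢ r (cong proj₂ eq)

  closed-rail : ∀ {c d r} → PathAdj k c d → ¬ Covered (d , r) →
                ∃ λ u → InN (Ladder k) (c , r) u × ¬ Covered u × u ≢ (d , r)
  closed-rail {c} {d} {r} cd ¬cw with hub? (toℕ c)
  ... | no ¬h = (c , other r) , ladder-nbr⁻ rung
              , uncovered (λ e → other-≢ r (trans (rail-on-zigzag cd ¬cw) (sym e))) ¬h
              , λ eq → other-≢ r (sym (cong proj₂ eq))
  ... | yes h with opposite-rail h cd
  ...   | d′ , cd′ , d′≢d = (d′ , r) , ladder-nbr⁻ (rail cd′)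
                          , uncovered (off-zigzag (rail-on-zigzag cd ¬cw) cd′) (hub-neighbours h cd′)
                          , λ eq → d′≢d (cong (λ v → toℕ (proj₁ v)) eq)

  closed : ForcingClosed (Ladder k) Covered
  closed cov vw ¬cw with ladder-nbr vw
  ... | self       = contradiction cov ¬cw
  ... | rung       = closed-rung ¬cw
  ... | above up   = closed-rail (inj₁ up) ¬cw
  ... | below down = closed-rail (inj₂ down) ¬cw

  hubs-fail : IsFPDS (Ladder k) hubs
  hubs-fail with column 0 (≤-trans (s≤s z≤n) four-columns)
  ... | c₀ , c₀≡ = failed (c₀ , fsuc fzero)
                     (uncovered (λ e → off-row (trans e (cong parity c₀≡))) (λ h → no-hub (subst Hub c₀≡ h)))
    where
      open Confinement (Ladder k) hubs Covered covered? seed closed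
      off-row : fsuc fzero ≢ parity 0
      off-row ()
      no-hub : ¬ Hub 0
      no-hub (() , _)

theorem7 : ∀ k → 4 ≤ k →
    let G = Path k □ Path 2
        m = ((k ∸ 4) + 2) / 3
    in (Σ (List (V G)) λ S → Unique S × IsFPDS G S × length S ≡ m)
       × (∀ (S : List (V G)) → Unique S → IsFPDS G S → length S ≤ m)
theorem7 k four-columns =
  (hubs , hubs-unique , hubs-fail , hubs-length) ,
  failed-size k (≤-trans (s≤s (s≤s z≤n)) four-columns)
  where open Construction k four-columns
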